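{- Let $a \geq 2$ be an integer. Then for every positive integer $n$, the integer $G_{n,a}$ is a multiple of $\pi_a(n)$.
   Context: For an integer $a \geq 2$, the generalized Genocchi numbers $G_{n,a}$ ($n \geq 0$) are defined by the power series expansion $$\frac{a t}{e^{(a-1)t} + e^{(a-2)t} + \dots + e^t + 1} = \sum_{n=0}^{\infty} G_{n,a} \frac{t^n}{n!};$$ it is known that all $G_{n,a}$ are integers. For positive integers $a$ and $n$, $\pi_a(n)$ denotes the greatest positive divisor of $n$ that is coprime to $a$, i.e. $\pi_a(n) = \prod_{p \text{ prime},\, p \nmid a} p^{\vartheta_p(n)}$, where $\vartheta_p$ is the $p$-adic valuation. -}

module Defs where

open import Data.Nat as ℕ using (ℕ; zero; suc; _^_; _≡ᵇ_)
open import Data.Nat.Divisibility using (_∣?_)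
open import Data.Nat.GCD using (gcd)
open import Data.Nat.Combinatorics using (_C_)
open import Data.Integer as ℤ using (ℤ; +_)
open import Data.Rational as ℚ using (ℚ; _/_; 0ℚ)
open import Data.List using (List; []; _∷_; _++_; map; foldr; upTo)
open import Data.Bool using (Bool; true; false; _∧_; if_then_else_)
open import Relation.Nullary.Decidable using (⌊_⌋)

ℕtoℚ : ℕ → ℚ
ℕtoℚ n = + n / 1

ℤtoℚ : ℤ → ℚ
ℤtoℚ k = k / 1

-- 1/a for a ≠ 0 (and 0 for a = 0, never used since a ≥ 2)
invℕ : ℕ → ℚ
invℕ zero = 0ℚ
invℕ (suc m) = + 1 / suc m

sumℚ : List ℚ → ℚ
sumℚ = foldr ℚ._+_ 0ℚ

-- S a j = Σ_{k=0}^{a-1} k^j  (with 0^0 = 1): the j-th EGF coefficient of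
-- e^{(a-1)t} + ... + e^t + 1
S : ℕ → ℕ → ℕ
S a j = foldr ℕ._+_ 0 (map (λ k → k ^ j) (upTo a))

lookupD : List ℚ → ℕ → ℚ
lookupD [] _ = 0ℚ
lookupD (x ∷ xs) zero = x
lookupD (x ∷ xs) (suc i) = lookupD xs i

-- EGF coefficient of a·t : a if m = 1, else 0
rhsCoeff : ℕ → ℕ → ℚ
rhsCoeff a m = if m ≡ᵇ 1 then ℕtoℚ a else 0ℚ

-- Comparing t^m/m! coefficients in  (Σ_k e^{kt}) · (Σ_n G_n t^n/n!) = a t :
--   Σ_{j=0}^{m} C(m,j) S(a,j) G_{m-j} = [m = 1] a,   with S(a,0) = a, so
--   G_m = (1/a) ([m=1] a − Σ_{j=1}^{m} C(m,j) S(a,j) G_{m-j}).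
-- 'prev' is the list [G_0, …, G_{m-1}].
nextG : ℕ → List ℚ → ℕ → ℚ
nextG a prev m =
  invℕ a ℚ.* (rhsCoeff a m ℚ.- sumℚ (map (λ i → let j = suc i in
     ℕtoℚ ((m C j) ℕ.* S a j) ℚ.* lookupD prev (m ℕ.∸ j)) (upTo m)))

table : ℕ → ℕ → List ℚ
table a zero = []
table a (suc m) = let p = table a m in p ++ (nextG a p m ∷ [])

G : ℕ → ℕ → ℚ
G a n = lookupD (table a (suc n)) n

πsearch : ℕ → ℕ → ℕ → ℕ
πsearch a n zero = 1
πsearch a n (suc d) =
  if ⌊ suc d ∣? n ⌋ ∧ (gcd (suc d) a ≡ᵇ 1) then suc d else πsearch a n d

π : ℕ → ℕ → ℕ
π a n = πsearch a n n

-- Let K be the integer sequence with exponential generating function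
-- a / (e^((a-1)at) + ... + e^(at) + 1), so that (m+1) K m = a^m G_{m+1,a}.
-- Evaluating the Appell polynomials of K at a·k and telescoping over k < a gives
--   Σ_{j=1}^{m+1} C(m+1,j) a^(2j) K (m+1-j) = a^(m+2).
-- By strong induction this yields a^m ∣ (m+1) K m: for j ≥ 2 the j-th term is
-- divisible by a^(m+2) because j ∣ d·a^(j-1) for some d coprime to a.
-- So G_{m+1,a} = (m+1) K m / a^m is an integer, and every divisor of m+1 that is
-- coprime to a divides it.
module Submission where

open import Defs
open import Data.Nat using (ℕ; _≤_)
open import Data.Integer using (ℤ; +_; _*_)
open import Data.Product using (∃)
open import Relation.Binary.PropositionalEquality using (_≡_)

open import Data.Nat as ℕ using (zero; suc; _<_; _∸_; _!; s≤s; z≤n; NonZero)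
import Data.Nat.Properties as ℕP
import Data.Nat.Tactic.RingSolver as ℕ-Solver
open import Data.Nat.Combinatorics using (_C_; nCk≡n!/k![n-k]!; k![n∸k]!∣n!; nC1≡n; nCn≡1; nCk≡nC[n∸k])
open import Data.Nat.DivMod using (m/n*n≡m)
import Data.Nat.Divisibility as ℕ∣
open import Data.Nat.GCD using (gcd; gcd[m,n]∣m; gcd[m,n]∣n)
open import Data.Nat.Coprimality using (Coprime; coprime-divisor; gcd≡1⇒coprime; 1-coprimeTo)
import Data.Nat.Coprimality as Coprimality
open import Data.Nat.Induction using (<-rec; <-wellFounded)
open import Data.Integer using (-[1+_]; _+_; _-_; -_; _^_; 0ℤ; 1ℤ)
import Data.Integer as ℤ
import Data.Integer.Properties as ℤP
open import Data.Integer.Tactic.RingSolver using (solve-∀)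
open import Data.Integer.Divisibility.Signed
  using (_∣_; divides; quotient; ∣ᵤ⇒∣; ∣⇒∣ᵤ; ∣-refl; ∣m∣n⇒∣m+n; ∣m+n∣n⇒∣m; ∣m⇒∣m*n; *-cancelˡ-∣)
open import Data.Rational as ℚ using (ℚ; mkℚ; 1ℚ)
import Data.Rational.Properties as ℚP
open import Data.Fin using (toℕ)
open import Data.Fin.Properties using (toℕ<n)
open import Data.List using ([]; _∷_; _++_; length; map; foldr; upTo; applyUpTo)
open import Data.List.Properties using (length-++; map-upTo)
open import Data.Product using (∃-syntax; _×_; _,_)
open import Data.Sum using (inj₁; inj₂)
open import Data.Bool using (true; false; T)
open import Data.Empty using (⊥-elim)
open import Function using (_∘_)
open import Induction.WellFounded using (module FixPoint)
open import Relation.Nullary using (yes; no)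
open import Relation.Binary.PropositionalEquality
  using (refl; sym; trans; cong; cong₂; subst; _≗_; module ≡-Reasoning)
open import Algebra.Properties.CommutativeMonoid.Sum ℤP.+-0-commutativeMonoid
  using (sum; ∑-distrib-+; ∑-comm; sum-cong-≗; sum-replicate)
open import Algebra.Properties.Semiring.Sum ℤP.+-*-semiring
  using (*-distribˡ-sum; *-distribʳ-sum)
import Algebra.Properties.CommutativeSemiring.Binomial ℤP.+-*-commutativeSemiring as Binomial
import Algebra.Properties.CommutativeSemiring.Exp ℤP.+-*-commutativeSemiring as CommExp
import Algebra.Properties.Semiring.Exp ℤP.+-*-semiring as SemiringExp
import Algebra.Properties.Semiring.Mult ℤP.+-*-semiring as SemiringMult

-- Finite sums over ℤ

Σ : ℕ → (ℕ → ℤ) → ℤ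
Σ n f = sum {n} (f ∘ toℕ)

Σ-cong : ∀ n {f g : ℕ → ℤ} → (∀ i → i < n → f i ≡ g i) → Σ n f ≡ Σ n g
Σ-cong n f≡g = sum-cong-≗ (λ i → f≡g (toℕ i) (toℕ<n i))

Σ-cong-≗ : ∀ n {f g : ℕ → ℤ} → f ≗ g → Σ n f ≡ Σ n g
Σ-cong-≗ n f≗g = Σ-cong n (λ i _ → f≗g i)

Σ-distrib-+ : ∀ n (f g : ℕ → ℤ) → Σ n (λ i → f i + g i) ≡ Σ n f + Σ n g
Σ-distrib-+ n f g = ∑-distrib-+ {n = n} (f ∘ toℕ) (g ∘ toℕ)

*-distribˡ-Σ : ∀ n x (f : ℕ → ℤ) → x * Σ n f ≡ Σ n (λ i → x * f i)
*-distribˡ-Σ n x f = *-distribˡ-sum {n = n} x (f ∘ toℕ)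

*-distribʳ-Σ : ∀ n x (f : ℕ → ℤ) → Σ n f * x ≡ Σ n (λ i → f i * x)
*-distribʳ-Σ n x f = *-distribʳ-sum {n = n} x (f ∘ toℕ)

Σ-comm : ∀ m n (F : ℕ → ℕ → ℤ) → Σ m (λ i → Σ n (F i)) ≡ Σ n (λ j → Σ m (λ i → F i j))
Σ-comm m n F = ∑-comm {m} {n} (λ i j → F (toℕ i) (toℕ j))

×≡pos* : ∀ n x → n SemiringMult.× x ≡ + n * x
×≡pos* zero    x = refl
×≡pos* (suc n) x = begin
  x + n SemiringMult.× x ≡⟨ cong (λ y → x + y) (×≡pos* n x) ⟩
  x + + n * x            ≡⟨ cong (_+ + n * x) (ℤP.*-identityˡ x) ⟨
  1ℤ * x + + n * x       ≡⟨ ℤP.*-distribʳ-+ x 1ℤ (+ n) ⟨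
  + suc n * x            ∎
  where open ≡-Reasoning

Σ-const : ∀ n x → Σ n (λ _ → x) ≡ + n * x
Σ-const n x = trans (sum-replicate n) (×≡pos* n x)

Σ-last : ∀ n f → Σ (suc n) f ≡ Σ n f + f n
Σ-last zero    f = ℤP.+-comm (f 0) 0ℤ
Σ-last (suc n) f = trans (cong (λ s → f 0 + s) (Σ-last n (f ∘ suc))) (sym (ℤP.+-assoc (f 0) _ _))

Σ-zero : ∀ n {f : ℕ → ℤ} → (∀ i → i < n → f i ≡ 0ℤ) → Σ n f ≡ 0ℤ
Σ-zero n f≡0 = trans (Σ-cong n f≡0) (trans (Σ-const n 0ℤ) (ℤP.*-zeroʳ (+ n)))

Σ-telescope : ∀ n (f : ℕ → ℤ) → Σ n (λ k → f (suc k) - f k) ≡ f n - f 0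
Σ-telescope zero    f = sym (ℤP.+-inverseʳ (f 0))
Σ-telescope (suc n) f =
  trans (cong (λ s → f 1 - f 0 + s) (Σ-telescope n (f ∘ suc))) (telescope (f 0) (f 1) (f (suc n)))
  where
  telescope : ∀ a b c → (b - a) + (c - b) ≡ c - a
  telescope = solve-∀

Σ-triangle : ∀ n (F : ℕ → ℕ → ℤ) →
  Σ n (λ j → Σ (suc j) (λ i → F i j)) ≡ Σ n (λ i → Σ (n ∸ i) (λ l → F i (i ℕ.+ l)))
Σ-triangle zero    F = refl
Σ-triangle (suc n) F = begin
  (F 0 0 + 0ℤ) + Σ n (λ j → F 0 (suc j) + Σ (suc j) (λ i → F (suc i) (suc j)))
    ≡⟨ cong (λ s → F 0 0 + 0ℤ + s) (Σ-distrib-+ n (λ j → F 0 (suc j)) (λ j → Σ (suc j) (λ i → F (suc i) (suc j)))) ⟩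
  (F 0 0 + 0ℤ) + (Σ n (λ j → F 0 (suc j)) + Σ n (λ j → Σ (suc j) (λ i → F (suc i) (suc j))))
    ≡⟨ cong (λ s → (F 0 0 + 0ℤ) + (Σ n (λ j → F 0 (suc j)) + s)) (Σ-triangle n (λ i j → F (suc i) (suc j))) ⟩
  (F 0 0 + 0ℤ) + (Σ n (λ j → F 0 (suc j)) + Σ n (λ i → Σ (n ∸ i) (λ l → F (suc i) (suc (i ℕ.+ l)))))
    ≡⟨ regroup (F 0 0) _ _ ⟩
  (F 0 0 + Σ n (λ j → F 0 (suc j))) + Σ n (λ i → Σ (n ∸ i) (λ l → F (suc i) (suc (i ℕ.+ l)))) ∎
  where
  open ≡-Reasoning
  regroup : ∀ a b c → (a + 0ℤ) + (b + c) ≡ (a + b) + c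
  regroup = solve-∀

^≡^ₛ : ∀ x n → x ^ n ≡ x SemiringExp.^ n
^≡^ₛ x zero    = refl
^≡^ₛ x (suc n) = cong (x *_) (^≡^ₛ x n)

Σ-binomial : ∀ n x y → (x + y) ^ n ≡ Σ (suc n) (λ k → + (n C k) * (x ^ k * y ^ (n ∸ k)))
Σ-binomial n x y = begin
  (x + y) ^ n                  ≡⟨ ^≡^ₛ (x + y) n ⟩
  (x + y) SemiringExp.^ n      ≡⟨ Binomial.theorem n x y ⟩
  Binomial.binomialExpansion x y n
    ≡⟨ sum-cong-≗ {n = suc n} (λ k → sym (term (toℕ k))) ⟩
  Σ (suc n) (λ k → + (n C k) * (x ^ k * y ^ (n ∸ k))) ∎
  where
  open ≡-Reasoning
  term : ∀ k → + (n C k) * (x ^ k * y ^ (n ∸ k)) ≡ (n C k) SemiringMult.× (x SemiringExp.^ k * y SemiringExp.^ (n ∸ k))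
  term k = trans (cong₂ (λ u v → + (n C k) * (u * v)) (^≡^ₛ x k) (^≡^ₛ y (n ∸ k))) (sym (×≡pos* (n C k) _))

^-distribʳ-* : ∀ x y n → (x * y) ^ n ≡ x ^ n * y ^ n
^-distribʳ-* x y n = begin
  (x * y) ^ n                          ≡⟨ ^≡^ₛ (x * y) n ⟩
  (x * y) SemiringExp.^ n              ≡⟨ CommExp.^-distrib-* x y n ⟩
  x SemiringExp.^ n * y SemiringExp.^ n ≡⟨ cong₂ _*_ (^≡^ₛ x n) (^≡^ₛ y n) ⟨
  x ^ n * y ^ n                        ∎
  where open ≡-Reasoning

pos-^ : ∀ m n → + (m ℕ.^ n) ≡ (+ m) ^ n
pos-^ m zero    = refl
pos-^ m (suc n) = trans (ℤP.pos-* m (m ℕ.^ n)) (cong (λ z → + m * z) (pos-^ m n))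

δ : ℕ → ℤ
δ zero    = 1ℤ
δ (suc _) = 0ℤ

Σ-δ : ∀ m (f : ℕ → ℤ) → Σ (suc m) (λ i → f i * δ (m ∸ i)) ≡ f m
Σ-δ m f = begin
  Σ (suc m) (λ i → f i * δ (m ∸ i))
    ≡⟨ Σ-last m (λ i → f i * δ (m ∸ i)) ⟩
  Σ m (λ i → f i * δ (m ∸ i)) + f m * δ (m ∸ m)
    ≡⟨ cong₂ _+_ (Σ-zero m off-diagonal) (cong (λ k → f m * δ k) (ℕP.n∸n≡0 m)) ⟩
  0ℤ + f m * 1ℤ
    ≡⟨ trans (ℤP.+-identityˡ (f m * 1ℤ)) (ℤP.*-identityʳ (f m)) ⟩
  f m ∎
  where
  open ≡-Reasoning
  off-diagonal : ∀ i → i < m → f i * δ (m ∸ i) ≡ 0ℤ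
  off-diagonal i i<m = trans (cong (λ k → f i * δ k) (ℕP.+-∸-assoc 1 i<m)) (ℤP.*-zeroʳ (f i))

Σ-∣ : ∀ n {d} {f : ℕ → ℤ} → (∀ i → i < n → d ∣ f i) → d ∣ Σ n f
Σ-∣ zero    {d} d∣f = divides 0ℤ (sym (ℤP.*-zeroˡ d))
Σ-∣ (suc n)     d∣f = ∣m∣n⇒∣m+n (d∣f 0 (s≤s z≤n)) (Σ-∣ n (λ i i<n → d∣f (suc i) (s≤s i<n)))

-- Binomial coefficients

nCk*k!*[n∸k]!≡n! : ∀ {n k} → k ≤ n → (n C k) ℕ.* (k ! ℕ.* (n ∸ k) !) ≡ n !
nCk*k!*[n∸k]!≡n! {n} {k} k≤n =
  trans (cong (ℕ._* (k ! ℕ.* (n ∸ k) !)) (nCk≡n!/k![n-k]! k≤n)) (m/n*n≡m (k![n∸k]!∣n! k≤n))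
  where instance _ = ℕP._!*_!≢0 k (n ∸ k)

nC[i+l]*[i+l]Ci≡nCi*[n∸i]Cl : ∀ n i l → i ℕ.+ l ≤ n →
  (n C (i ℕ.+ l)) ℕ.* ((i ℕ.+ l) C i) ≡ (n C i) ℕ.* ((n ∸ i) C l)
nC[i+l]*[i+l]Ci≡nCi*[n∸i]Cl n i l i+l≤n =
  ℕP.*-cancelʳ-≡ _ _ (i ! ℕ.* (l ! ℕ.* (n ∸ i ∸ l) !)) (trans lhs (sym rhs))
  where
  open ≡-Reasoning
  instance _ = ℕP.m*n≢0 (i !) (l ! ℕ.* (n ∸ i ∸ l) !) {{ℕP._!≢0 i}} {{ℕP._!*_!≢0 l (n ∸ i ∸ l)}}
  regroupˡ : ∀ c d x y z → c ℕ.* d ℕ.* (x ℕ.* (y ℕ.* z)) ≡ c ℕ.* (d ℕ.* (x ℕ.* y) ℕ.* z)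
  regroupˡ = ℕ-Solver.solve-∀
  regroupʳ : ∀ c d x y z → c ℕ.* d ℕ.* (x ℕ.* (y ℕ.* z)) ≡ c ℕ.* (x ℕ.* (d ℕ.* (y ℕ.* z)))
  regroupʳ = ℕ-Solver.solve-∀
  lhs : (n C (i ℕ.+ l)) ℕ.* ((i ℕ.+ l) C i) ℕ.* (i ! ℕ.* (l ! ℕ.* (n ∸ i ∸ l) !)) ≡ n !
  lhs = begin
    (n C (i ℕ.+ l)) ℕ.* ((i ℕ.+ l) C i) ℕ.* (i ! ℕ.* (l ! ℕ.* (n ∸ i ∸ l) !))
      ≡⟨ regroupˡ (n C (i ℕ.+ l)) ((i ℕ.+ l) C i) (i !) (l !) ((n ∸ i ∸ l) !) ⟩
    (n C (i ℕ.+ l)) ℕ.* (((i ℕ.+ l) C i) ℕ.* (i ! ℕ.* l !) ℕ.* (n ∸ i ∸ l) !)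
      ≡⟨ cong₂ (λ u v → (n C (i ℕ.+ l)) ℕ.* (((i ℕ.+ l) C i) ℕ.* (i ! ℕ.* u !) ℕ.* v !))
               (sym (ℕP.m+n∸m≡n i l)) (ℕP.∸-+-assoc n i l) ⟩
    (n C (i ℕ.+ l)) ℕ.* (((i ℕ.+ l) C i) ℕ.* (i ! ℕ.* (i ℕ.+ l ∸ i) !) ℕ.* (n ∸ (i ℕ.+ l)) !)
      ≡⟨ cong (λ u → (n C (i ℕ.+ l)) ℕ.* (u ℕ.* (n ∸ (i ℕ.+ l)) !)) (nCk*k!*[n∸k]!≡n! (ℕP.m≤m+n i l)) ⟩
    (n C (i ℕ.+ l)) ℕ.* ((i ℕ.+ l) ! ℕ.* (n ∸ (i ℕ.+ l)) !)
      ≡⟨ nCk*k!*[n∸k]!≡n! i+l≤n ⟩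
    n ! ∎
  l≤n∸i : l ≤ n ∸ i
  l≤n∸i = ℕP.m+n≤o⇒m≤o∸n l (subst (_≤ n) (ℕP.+-comm i l) i+l≤n)
  rhs : (n C i) ℕ.* ((n ∸ i) C l) ℕ.* (i ! ℕ.* (l ! ℕ.* (n ∸ i ∸ l) !)) ≡ n !
  rhs = begin
    (n C i) ℕ.* ((n ∸ i) C l) ℕ.* (i ! ℕ.* (l ! ℕ.* (n ∸ i ∸ l) !))
      ≡⟨ regroupʳ (n C i) ((n ∸ i) C l) (i !) (l !) ((n ∸ i ∸ l) !) ⟩
    (n C i) ℕ.* (i ! ℕ.* (((n ∸ i) C l) ℕ.* (l ! ℕ.* (n ∸ i ∸ l) !)))
      ≡⟨ cong (λ u → (n C i) ℕ.* (i ! ℕ.* u)) (nCk*k!*[n∸k]!≡n! l≤n∸i) ⟩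
    (n C i) ℕ.* (i ! ℕ.* (n ∸ i) !)
      ≡⟨ nCk*k!*[n∸k]!≡n! (ℕP.≤-trans (ℕP.m≤m+n i l) i+l≤n) ⟩
    n ! ∎

[1+k]Ck≡1+k : ∀ k → suc k C k ≡ suc k
[1+k]Ck≡1+k k = begin
  suc k C k           ≡⟨ nCk≡nC[n∸k] (ℕP.n≤1+n k) ⟩
  suc k C (suc k ∸ k) ≡⟨ cong (suc k C_) (ℕP.m+n∸n≡m 1 k) ⟩
  suc k C 1           ≡⟨ nC1≡n (suc k) ⟩
  suc k               ∎
  where open ≡-Reasoning

[1+k]*nC[1+k]≡[n∸k]*nCk : ∀ {n k} → k < n → suc k ℕ.* (n C suc k) ≡ (n ∸ k) ℕ.* (n C k)
[1+k]*nC[1+k]≡[n∸k]*nCk {n} {k} k<n = begin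
  suc k ℕ.* (n C suc k)               ≡⟨ ℕP.*-comm (suc k) _ ⟩
  (n C suc k) ℕ.* suc k               ≡⟨ cong ((n C suc k) ℕ.*_) ([1+k]Ck≡1+k k) ⟨
  (n C suc k) ℕ.* (suc k C k)         ≡⟨ cong (λ i → (n C i) ℕ.* (i C k)) (ℕP.+-comm 1 k) ⟩
  (n C (k ℕ.+ 1)) ℕ.* ((k ℕ.+ 1) C k) ≡⟨ nC[i+l]*[i+l]Ci≡nCi*[n∸i]Cl n k 1 (subst (_≤ n) (ℕP.+-comm 1 k) k<n) ⟩
  (n C k) ℕ.* ((n ∸ k) C 1)           ≡⟨ cong ((n C k) ℕ.*_) (nC1≡n (n ∸ k)) ⟩
  (n C k) ℕ.* (n ∸ k)                 ≡⟨ ℕP.*-comm (n C k) _ ⟩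
  (n ∸ k) ℕ.* (n C k)                 ∎
  where open ≡-Reasoning

[1+k]*[1+n]C[1+k]≡[1+n]*nCk : ∀ {n k} → k ≤ n → suc k ℕ.* (suc n C suc k) ≡ suc n ℕ.* (n C k)
[1+k]*[1+n]C[1+k]≡[1+n]*nCk {n} {k} k≤n = begin
  suc k ℕ.* (suc n C suc k)           ≡⟨ ℕP.*-comm (suc k) _ ⟩
  (suc n C suc k) ℕ.* suc k           ≡⟨ cong ((suc n C suc k) ℕ.*_) (sym (nC1≡n (suc k))) ⟩
  (suc n C suc k) ℕ.* (suc k C 1)     ≡⟨ nC[i+l]*[i+l]Ci≡nCi*[n∸i]Cl (suc n) 1 k (ℕ.s≤s k≤n) ⟩
  (suc n C 1) ℕ.* (n C k)             ≡⟨ cong (ℕ._* (n C k)) (nC1≡n (suc n)) ⟩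
  suc n ℕ.* (n C k)                   ∎
  where open ≡-Reasoning

[1+n∸k]*[1+n]Ck≡[1+n]*nCk : ∀ {n k} → k ≤ n → (suc n ∸ k) ℕ.* (suc n C k) ≡ suc n ℕ.* (n C k)
[1+n∸k]*[1+n]Ck≡[1+n]*nCk k≤n =
  trans (sym ([1+k]*nC[1+k]≡[n∸k]*nCk (ℕ.s≤s k≤n))) ([1+k]*[1+n]C[1+k]≡[1+n]*nCk k≤n)

-- Coprimality

coprime-* : ∀ {m n o} → Coprime m n → Coprime m o → Coprime m (n ℕ.* o)
coprime-* m⊥n m⊥o (i∣m , i∣n*o) =
  m⊥o (i∣m , coprime-divisor (λ (j∣i , j∣n) → m⊥n (ℕ∣.∣-trans j∣i i∣m , j∣n)) i∣n*o)

coprime-^ : ∀ {m n} → Coprime m n → ∀ k → Coprime m (n ℕ.^ k)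
coprime-^ {m} m⊥n zero    = Coprimality.sym (1-coprimeTo m)
coprime-^     m⊥n (suc k) = coprime-* m⊥n (coprime-^ m⊥n k)

coprime-∣-*-cancel : ∀ {k n} y → Coprime k n → + k ∣ + n * y → + k ∣ y
coprime-∣-*-cancel {n = n} y k⊥n k∣ny =
  ∣ᵤ⇒∣ (coprime-divisor k⊥n (subst (_ ℕ∣.∣_) (ℤP.abs-* (+ n) y) (∣⇒∣ᵤ k∣ny)))

a^m∣a^n : ∀ a {m n} → m ≤ n → a ℕ.^ m ℕ∣.∣ a ℕ.^ n
a^m∣a^n a {m} m≤n with ℕP.m≤n⇒∃[o]m+o≡n m≤n
... | o , refl = subst (a ℕ.^ m ℕ∣.∣_) (sym (ℕP.^-distribˡ-+-* a m o)) (ℕ∣.m∣m*n (a ℕ.^ o))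

[1+n]∣coprime*a^n : ∀ a n → ∃[ d ] Coprime d a × suc n ℕ∣.∣ d ℕ.* a ℕ.^ n
[1+n]∣coprime*a^n a = <-rec _ step
  where
  step : ∀ n → (∀ {m} → m < n → ∃[ d ] Coprime d a × suc m ℕ∣.∣ d ℕ.* a ℕ.^ m) →
         ∃[ d ] Coprime d a × suc n ℕ∣.∣ d ℕ.* a ℕ.^ n
  step n ih with gcd (suc n) a | gcd[m,n]∣m (suc n) a | gcd[m,n]∣n (suc n) a | gcd≡1⇒coprime {suc n} {a}
  ... | 0 | g∣n+1 | _ | _ = ⊥-elim (ℕP.1+n≢0 (ℕ∣.0∣⇒≡0 g∣n+1))
  ... | 1 | _ | _ | coprime = suc n , coprime refl , ℕ∣.m∣m*n _
  ... | g@(suc (suc _)) | ℕ∣.divides zero    n+1≡0 | _ | _ = ⊥-elim (ℕP.1+n≢0 n+1≡0)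
  ... | g@(suc (suc _)) | ℕ∣.divides (suc m) n+1≡[1+m]g | g∣a | _ =
    let d , d⊥a , [1+m]∣d*a^m = ih m<n in d , d⊥a , (begin
      suc n              ≡⟨ n+1≡[1+m]g ⟩
      suc m ℕ.* g        ∣⟨ ℕ∣.*-pres-∣ [1+m]∣d*a^m g∣a ⟩
      d ℕ.* a ℕ.^ m ℕ.* a  ≡⟨ ℕP.*-assoc d _ a ⟩
      d ℕ.* (a ℕ.^ m ℕ.* a)  ≡⟨ cong (d ℕ.*_) (ℕP.*-comm (a ℕ.^ m) a) ⟩
      d ℕ.* a ℕ.^ suc m  ∣⟨ ℕ∣.*-monoʳ-∣ d (a^m∣a^n a m<n) ⟩
      d ℕ.* a ℕ.^ n      ∎)
    where
    open ℕ∣.∣-Reasoning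
    m<n : m < n
    m<n = ℕP.≤-pred (ℕ∣.quotient-< (ℕ∣.divides (suc m) n+1≡[1+m]g))

-- The rational encoding of G and π

-- ℤtoℚ x is already in lowest terms, so sums and products of such values compute to a fraction over 1.
ℤtoℚ≡mkℚ : ∀ x → ℤtoℚ x ≡ mkℚ x 0 (Coprimality.sym (1-coprimeTo ℤ.∣ x ∣))
ℤtoℚ≡mkℚ x = ℚP.↥p/↧p≡p (mkℚ x 0 (Coprimality.sym (1-coprimeTo ℤ.∣ x ∣)))

ℤtoℚ-+ : ∀ x y → ℤtoℚ (x + y) ≡ ℤtoℚ x ℚ.+ ℤtoℚ y
ℤtoℚ-+ x y = begin
  ℤtoℚ (x + y)
    ≡⟨ cong₂ (λ u v → (u + v) ℚ./ 1) (ℤP.*-identityʳ x) (ℤP.*-identityʳ y) ⟨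
  (x * + 1 + y * + 1) ℚ./ 1
    ≡⟨ cong₂ ℚ._+_ (ℤtoℚ≡mkℚ x) (ℤtoℚ≡mkℚ y) ⟨
  ℤtoℚ x ℚ.+ ℤtoℚ y ∎
  where open ≡-Reasoning

ℤtoℚ-* : ∀ x y → ℤtoℚ (x * y) ≡ ℤtoℚ x ℚ.* ℤtoℚ y
ℤtoℚ-* x y = sym (cong₂ ℚ._*_ (ℤtoℚ≡mkℚ x) (ℤtoℚ≡mkℚ y))

ℤtoℚ-neg : ∀ x → ℤtoℚ (- x) ≡ ℚ.- ℤtoℚ x
ℤtoℚ-neg x = trans (ℤtoℚ≡mkℚ (- x)) (trans (neg-mkℚ x) (cong ℚ.-_ (sym (ℤtoℚ≡mkℚ x))))
  where
  neg-mkℚ : ∀ x → mkℚ (- x) 0 (Coprimality.sym (1-coprimeTo ℤ.∣ - x ∣))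
                ≡ ℚ.- mkℚ x 0 (Coprimality.sym (1-coprimeTo ℤ.∣ x ∣))
  neg-mkℚ (+ zero)  = refl
  neg-mkℚ (+ suc n) = refl
  neg-mkℚ -[1+ n ]  = refl

ℤtoℚ-- : ∀ x y → ℤtoℚ (x - y) ≡ ℤtoℚ x ℚ.- ℤtoℚ y
ℤtoℚ-- x y = trans (ℤtoℚ-+ x (- y)) (cong (ℤtoℚ x ℚ.+_) (ℤtoℚ-neg y))

invℕ-cancel : ∀ a .{{_ : NonZero a}} y → invℕ a ℚ.* ℤtoℚ (+ a * y) ≡ ℤtoℚ y
invℕ-cancel (suc n) y = begin
  invℕ (suc n) ℚ.* ℤtoℚ (+ suc n * y)             ≡⟨ cong (invℕ (suc n) ℚ.*_) (ℤtoℚ-* (+ suc n) y) ⟩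
  invℕ (suc n) ℚ.* (ℤtoℚ (+ suc n) ℚ.* ℤtoℚ y)   ≡⟨ ℚP.*-assoc (invℕ (suc n)) _ _ ⟨
  (invℕ (suc n) ℚ.* ℤtoℚ (+ suc n)) ℚ.* ℤtoℚ y   ≡⟨ cong (ℚ._* ℤtoℚ y) inverse ⟩
  1ℚ ℚ.* ℤtoℚ y                                  ≡⟨ ℚP.*-identityˡ (ℤtoℚ y) ⟩
  ℤtoℚ y                                         ∎
  where
  open ≡-Reasoning
  inverse : invℕ (suc n) ℚ.* ℤtoℚ (+ suc n) ≡ 1ℚ
  inverse = trans (cong₂ ℚ._*_ (ℚP.↥p/↧p≡p (mkℚ (+ 1) n (1-coprimeTo (suc n)))) (ℤtoℚ≡mkℚ (+ suc n)))
                  (ℚP.*-inverseˡ (mkℚ (+ suc n) 0 (Coprimality.sym (1-coprimeTo (suc n)))))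

sumℚ-applyUpTo : ∀ n (f : ℕ → ℚ) (g : ℕ → ℤ) → (∀ i → i < n → f i ≡ ℤtoℚ (g i)) →
  sumℚ (applyUpTo f n) ≡ ℤtoℚ (Σ n g)
sumℚ-applyUpTo zero    f g f≡g = refl
sumℚ-applyUpTo (suc n) f g f≡g =
  trans (cong₂ ℚ._+_ (f≡g 0 (s≤s z≤n)) (sumℚ-applyUpTo n (f ∘ suc) (g ∘ suc) (λ i i<n → f≡g (suc i) (s≤s i<n))))
        (sym (ℤtoℚ-+ (g 0) (Σ n (g ∘ suc))))

length-table : ∀ a k → length (table a k) ≡ k
length-table a zero    = refl
length-table a (suc k) = trans (length-++ (table a k)) (trans (cong (ℕ._+ 1) (length-table a k)) (ℕP.+-comm k 1))

lookupD-++ˡ : ∀ xs ys i → i < length xs → lookupD (xs ++ ys) i ≡ lookupD xs i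
lookupD-++ˡ (x ∷ xs) ys zero    _         = refl
lookupD-++ˡ (x ∷ xs) ys (suc i) (s≤s i<n) = lookupD-++ˡ xs ys i i<n

lookupD-length : ∀ xs y ys → lookupD (xs ++ y ∷ ys) (length xs) ≡ y
lookupD-length []       y ys = refl
lookupD-length (x ∷ xs) y ys = lookupD-length xs y ys

G-next : ∀ a k → G a k ≡ nextG a (table a k) k
G-next a k = subst (λ j → lookupD (table a k ++ x ∷ []) j ≡ x) (length-table a k) (lookupD-length (table a k) x [])
  where x = nextG a (table a k) k

lookupD-table : ∀ a k i → i < k → lookupD (table a k) i ≡ G a i
lookupD-table a (suc k) i i<1+k with ℕP.m≤n⇒m<n∨m≡n (ℕP.≤-pred i<1+k)
... | inj₁ i<k  = trans (lookupD-++ˡ (table a k) _ i (subst (i <_) (sym (length-table a k)) i<k)) (lookupD-table a k i i<k)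
... | inj₂ refl = refl

pos-foldr-applyUpTo : ∀ n (f : ℕ → ℕ) → + foldr ℕ._+_ 0 (applyUpTo f n) ≡ Σ n (λ i → + f i)
pos-foldr-applyUpTo zero    f = refl
pos-foldr-applyUpTo (suc n) f = trans (ℤP.pos-+ (f 0) _) (cong (λ s → + f 0 + s) (pos-foldr-applyUpTo n (f ∘ suc)))

πsearch-spec : ∀ a n d → πsearch a n d ℕ∣.∣ n × Coprime (πsearch a n d) a
πsearch-spec a n zero = ℕ∣.1∣ n , 1-coprimeTo a
πsearch-spec a n (suc d) with suc d ℕ∣.∣? n
... | no  _ = πsearch-spec a n d
... | yes d∣n with gcd (suc d) a ℕ.≡ᵇ 1 in eq
...   | true  = d∣n , gcd≡1⇒coprime (ℕP.≡ᵇ⇒≡ (gcd (suc d) a) 1 (subst T (sym eq) _))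
...   | false = πsearch-spec a n d

-- Appell polynomials

appell : (ℕ → ℤ) → ℕ → ℤ → ℤ
appell c m x = Σ (suc m) (λ j → + (m C j) * x ^ j * c (m ∸ j))

appell-shift : ∀ c m x y → appell c m (x + y) ≡ Σ (suc m) (λ i → + (m C i) * y ^ i * appell c (m ∸ i) x)
appell-shift c m x y = begin
  appell c m (x + y)                                      ≡⟨ Σ-cong-≗ (suc m) expand ⟩
  Σ (suc m) (λ j → Σ (suc j) (λ i → F i j))              ≡⟨ Σ-triangle (suc m) F ⟩
  Σ (suc m) (λ i → Σ (suc m ∸ i) (λ l → F i (i ℕ.+ l)))  ≡⟨ Σ-cong (suc m) (λ i i<1+m → collect i (ℕP.≤-pred i<1+m)) ⟩
  Σ (suc m) (λ i → + (m C i) * y ^ i * appell c (m ∸ i) x) ∎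
  where
  open ≡-Reasoning
  F : ℕ → ℕ → ℤ
  F i j = + (m C j) * (+ (j C i) * (y ^ i * x ^ (j ∸ i))) * c (m ∸ j)

  expand : ∀ j → + (m C j) * (x + y) ^ j * c (m ∸ j) ≡ Σ (suc j) (λ i → F i j)
  expand j = begin
    + (m C j) * (x + y) ^ j * c (m ∸ j)
      ≡⟨ cong (λ z → + (m C j) * z * c (m ∸ j)) (trans (cong (_^ j) (ℤP.+-comm x y)) (Σ-binomial j y x)) ⟩
    + (m C j) * Σ (suc j) (λ i → + (j C i) * (y ^ i * x ^ (j ∸ i))) * c (m ∸ j)
      ≡⟨ cong (_* c (m ∸ j)) (*-distribˡ-Σ (suc j) (+ (m C j)) (λ i → + (j C i) * (y ^ i * x ^ (j ∸ i)))) ⟩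
    Σ (suc j) (λ i → + (m C j) * (+ (j C i) * (y ^ i * x ^ (j ∸ i)))) * c (m ∸ j)
      ≡⟨ *-distribʳ-Σ (suc j) (c (m ∸ j)) (λ i → + (m C j) * (+ (j C i) * (y ^ i * x ^ (j ∸ i)))) ⟩
    Σ (suc j) (λ i → F i j) ∎

  term : ∀ i l → i ℕ.+ l ≤ m →
    F i (i ℕ.+ l) ≡ + (m C i) * y ^ i * (+ ((m ∸ i) C l) * x ^ l * c (m ∸ i ∸ l))
  term i l i+l≤m = begin
    + (m C (i ℕ.+ l)) * (+ ((i ℕ.+ l) C i) * (y ^ i * x ^ (i ℕ.+ l ∸ i))) * c (m ∸ (i ℕ.+ l))
      ≡⟨ cong₂ (λ u v → + (m C (i ℕ.+ l)) * (+ ((i ℕ.+ l) C i) * (y ^ i * x ^ u)) * c v)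
               (ℕP.m+n∸m≡n i l) (sym (ℕP.∸-+-assoc m i l)) ⟩
    + (m C (i ℕ.+ l)) * (+ ((i ℕ.+ l) C i) * (y ^ i * x ^ l)) * c (m ∸ i ∸ l)
      ≡⟨ regroup (+ (m C (i ℕ.+ l))) (+ ((i ℕ.+ l) C i)) (y ^ i) (x ^ l) (c (m ∸ i ∸ l)) ⟩
    + (m C (i ℕ.+ l)) * + ((i ℕ.+ l) C i) * (y ^ i * x ^ l * c (m ∸ i ∸ l))
      ≡⟨ cong (_* (y ^ i * x ^ l * c (m ∸ i ∸ l))) trinomial ⟩
    + (m C i) * + ((m ∸ i) C l) * (y ^ i * x ^ l * c (m ∸ i ∸ l))
      ≡⟨ regroup′ (+ (m C i)) (+ ((m ∸ i) C l)) (y ^ i) (x ^ l) (c (m ∸ i ∸ l)) ⟩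
    + (m C i) * y ^ i * (+ ((m ∸ i) C l) * x ^ l * c (m ∸ i ∸ l)) ∎
    where
    regroup : ∀ p q u v w → p * (q * (u * v)) * w ≡ p * q * (u * v * w)
    regroup = solve-∀
    regroup′ : ∀ p q u v w → p * q * (u * v * w) ≡ p * u * (q * v * w)
    regroup′ = solve-∀
    trinomial : + (m C (i ℕ.+ l)) * + ((i ℕ.+ l) C i) ≡ + (m C i) * + ((m ∸ i) C l)
    trinomial = trans (sym (ℤP.pos-* (m C (i ℕ.+ l)) _))
                      (trans (cong +_ (nC[i+l]*[i+l]Ci≡nCi*[n∸i]Cl m i l i+l≤m)) (ℤP.pos-* (m C i) _))

  collect : ∀ i → i ≤ m → Σ (suc m ∸ i) (λ l → F i (i ℕ.+ l)) ≡ + (m C i) * y ^ i * appell c (m ∸ i) x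
  collect i i≤m = begin
    Σ (suc m ∸ i) (λ l → F i (i ℕ.+ l))
      ≡⟨ cong (λ n → Σ n (λ l → F i (i ℕ.+ l))) (ℕP.+-∸-assoc 1 i≤m) ⟩
    Σ (suc (m ∸ i)) (λ l → F i (i ℕ.+ l))
      ≡⟨ Σ-cong (suc (m ∸ i)) (λ l l≤m∸i → term i l (i+l≤m l (ℕP.≤-pred l≤m∸i))) ⟩
    Σ (suc (m ∸ i)) (λ l → + (m C i) * y ^ i * (+ ((m ∸ i) C l) * x ^ l * c (m ∸ i ∸ l)))
      ≡⟨ *-distribˡ-Σ (suc (m ∸ i)) (+ (m C i) * y ^ i) (λ l → + ((m ∸ i) C l) * x ^ l * c (m ∸ i ∸ l)) ⟨
    + (m C i) * y ^ i * appell c (m ∸ i) x ∎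
    where
    i+l≤m : ∀ l → l ≤ m ∸ i → i ℕ.+ l ≤ m
    i+l≤m l l≤m∸i = subst (_≤ m) (ℕP.+-comm l i) (ℕP.m≤o∸n⇒m+n≤o l i≤m l≤m∸i)

appell-increment : ∀ c m x y →
  appell c (suc m) (x + y) - appell c (suc m) x ≡ Σ (suc m) (λ i → + (suc m C suc i) * y ^ suc i * appell c (m ∸ i) x)
appell-increment c m x y =
  trans (cong (_- appell c (suc m) x) (appell-shift c (suc m) x y)) (cancel (appell c (suc m) x) _)
  where
  cancel : ∀ p t → (+ 1 * 1ℤ * p + t) - p ≡ t
  cancel = solve-∀

appell-sub-zero : ∀ c m x →
  appell c (suc m) x - appell c (suc m) 0ℤ ≡ Σ (suc m) (λ i → + (suc m C suc i) * x ^ suc i * c (m ∸ i))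
appell-sub-zero c m x =
  trans (cong (λ t → appell c (suc m) x - (+ 1 * 1ℤ * c (suc m) + t)) (Σ-zero (suc m) vanish)) (cancel (c (suc m)) _)
  where
  vanish : ∀ i → i < suc m → + (suc m C suc i) * 0ℤ ^ suc i * c (m ∸ i) ≡ 0ℤ
  vanish i _ = trans (cong (_* c (m ∸ i)) (ℤP.*-zeroʳ (+ (suc m C suc i)))) (ℤP.*-zeroˡ (c (m ∸ i)))
  cancel : ∀ k t → (+ 1 * 1ℤ * k + t) - (+ 1 * 1ℤ * k + 0ℤ) ≡ t
  cancel = solve-∀

-- Genocchi numbers

module _ (a : ℕ) .{{_ : NonZero a}} where

  A : ℤ
  A = + a

  powerSum : ℕ → ℤ
  powerSum j = Σ a (λ k → (+ k) ^ j)

  powerSum-zero : powerSum 0 ≡ A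
  powerSum-zero = trans (Σ-const a 1ℤ) (ℤP.*-identityʳ A)

  private
    K-step : ∀ m → (∀ {j} → j < m → ℤ) → ℤ
    K-step zero    _  = 1ℤ
    K-step (suc m) K< =
      - Σ (suc m) (λ i → + (suc m C suc i) * A ^ i * powerSum (suc i) * K< (s≤s (ℕP.m∸n≤m m i)))

    K-step-ext : ∀ m {K< K<′ : ∀ {j} → j < m → ℤ} →
      (∀ {j} (j<m : j < m) → K< j<m ≡ K<′ j<m) → K-step m K< ≡ K-step m K<′
    K-step-ext zero    _     = refl
    K-step-ext (suc m) K<≡K<′ =
      cong -_ (Σ-cong-≗ (suc m) (λ i →
        cong (+ (suc m C suc i) * A ^ i * powerSum (suc i) *_) (K<≡K<′ (s≤s (ℕP.m∸n≤m m i)))))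

  K : ℕ → ℤ
  K = <-rec (λ _ → ℤ) K-step

  private
    K-unfold : ∀ m → K m ≡ K-step m (λ {j} _ → K j)
    K-unfold m = FixPoint.unfold-wfRec <-wellFounded (λ _ → ℤ) K-step K-step-ext {m}

  K-convolution : ∀ m → Σ (suc m) (λ j → + (m C j) * A ^ j * powerSum j * K (m ∸ j)) ≡ A * δ m
  K-convolution zero = begin
    + 1 * 1ℤ * powerSum 0 * K 0 + 0ℤ ≡⟨ cong₂ (λ s k → + 1 * 1ℤ * s * k + 0ℤ) powerSum-zero (K-unfold 0) ⟩
    + 1 * 1ℤ * A * 1ℤ + 0ℤ           ≡⟨ simplify A ⟩
    A * 1ℤ                           ∎
    where
    open ≡-Reasoning
    simplify : ∀ A → + 1 * 1ℤ * A * 1ℤ + 0ℤ ≡ A * 1ℤ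
    simplify = solve-∀
  K-convolution (suc m) = begin
    + 1 * 1ℤ * powerSum 0 * K (suc m) + Σ (suc m) (λ i → + (suc m C suc i) * A ^ suc i * powerSum (suc i) * K (m ∸ i))
      ≡⟨ cong₂ (λ s t → + 1 * 1ℤ * s * K (suc m) + t) powerSum-zero
               (trans (Σ-cong-≗ (suc m) (λ i → pull-A (+ (suc m C suc i)) A (A ^ i) (powerSum (suc i)) (K (m ∸ i))))
                      (sym (*-distribˡ-Σ (suc m) A recursion-terms))) ⟩
    + 1 * 1ℤ * A * K (suc m) + A * Σ (suc m) recursion-terms
      ≡⟨ cong (λ k → + 1 * 1ℤ * A * k + A * Σ (suc m) recursion-terms) (K-unfold (suc m)) ⟩
    + 1 * 1ℤ * A * - Σ (suc m) recursion-terms + A * Σ (suc m) recursion-terms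
      ≡⟨ cancel A (Σ (suc m) recursion-terms) ⟩
    A * 0ℤ ∎
    where
    open ≡-Reasoning
    recursion-terms : ℕ → ℤ
    recursion-terms i = + (suc m C suc i) * A ^ i * powerSum (suc i) * K (m ∸ i)
    pull-A : ∀ c A x s k → c * (A * x) * s * k ≡ A * (c * x * s * k)
    pull-A = solve-∀
    cancel : ∀ A t → + 1 * 1ℤ * A * - t + A * t ≡ A * 0ℤ
    cancel = solve-∀

  Σ-appell-K : ∀ m → Σ a (λ k → appell K m (A * + k)) ≡ A * δ m
  Σ-appell-K m = begin
    Σ a (λ k → appell K m (A * + k))
      ≡⟨ Σ-comm a (suc m) (λ k j → + (m C j) * (A * + k) ^ j * K (m ∸ j)) ⟩
    Σ (suc m) (λ j → Σ a (λ k → + (m C j) * (A * + k) ^ j * K (m ∸ j)))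
      ≡⟨ Σ-cong-≗ (suc m) sum-over-k ⟩
    Σ (suc m) (λ j → + (m C j) * A ^ j * powerSum j * K (m ∸ j))
      ≡⟨ K-convolution m ⟩
    A * δ m ∎
    where
    open ≡-Reasoning
    sum-over-k : ∀ j → Σ a (λ k → + (m C j) * (A * + k) ^ j * K (m ∸ j)) ≡ + (m C j) * A ^ j * powerSum j * K (m ∸ j)
    sum-over-k j = begin
      Σ a (λ k → + (m C j) * (A * + k) ^ j * K (m ∸ j))
        ≡⟨ Σ-cong-≗ a (λ k → trans (cong (λ z → + (m C j) * z * K (m ∸ j)) (^-distribʳ-* A (+ k) j))
                                   (regroup (+ (m C j)) (A ^ j) ((+ k) ^ j) (K (m ∸ j)))) ⟩
      Σ a (λ k → (+ (m C j) * A ^ j) * (+ k) ^ j * K (m ∸ j))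
        ≡⟨ *-distribʳ-Σ a (K (m ∸ j)) (λ k → (+ (m C j) * A ^ j) * (+ k) ^ j) ⟨
      Σ a (λ k → (+ (m C j) * A ^ j) * (+ k) ^ j) * K (m ∸ j)
        ≡⟨ cong (_* K (m ∸ j)) (*-distribˡ-Σ a (+ (m C j) * A ^ j) (λ k → (+ k) ^ j)) ⟨
      + (m C j) * A ^ j * powerSum j * K (m ∸ j) ∎
      where
      regroup : ∀ c x y k → c * (x * y) * k ≡ c * x * y * k
      regroup = solve-∀

  K-telescoped : ∀ m → Σ (suc m) (λ i → + (suc m C suc i) * (A * A) ^ suc i * K (m ∸ i)) ≡ A ^ suc (suc m)
  K-telescoped m = begin
    Σ (suc m) (λ i → + (suc m C suc i) * (A * A) ^ suc i * K (m ∸ i))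
      ≡⟨ appell-sub-zero K m (A * A) ⟨
    P a - appell K (suc m) 0ℤ
      ≡⟨ cong (λ z → P a - appell K (suc m) z) (ℤP.*-zeroʳ A) ⟨
    P a - P 0
      ≡⟨ Σ-telescope a P ⟨
    Σ a (λ k → P (suc k) - P k)
      ≡⟨ Σ-cong-≗ a increment ⟩
    Σ a (λ k → Σ (suc m) (λ i → + (suc m C suc i) * A ^ suc i * appell K (m ∸ i) (A * + k)))
      ≡⟨ Σ-comm a (suc m) (λ k i → + (suc m C suc i) * A ^ suc i * appell K (m ∸ i) (A * + k)) ⟩
    Σ (suc m) (λ i → Σ a (λ k → + (suc m C suc i) * A ^ suc i * appell K (m ∸ i) (A * + k)))
      ≡⟨ Σ-cong-≗ (suc m) sum-over-k ⟩
    Σ (suc m) (λ i → + (suc m C suc i) * A ^ suc i * A * δ (m ∸ i))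
      ≡⟨ Σ-δ m (λ i → + (suc m C suc i) * A ^ suc i * A) ⟩
    + (suc m C suc m) * A ^ suc m * A
      ≡⟨ cong (λ c → + c * A ^ suc m * A) (nCn≡1 (suc m)) ⟩
    + 1 * A ^ suc m * A
      ≡⟨ simplify A (A ^ suc m) ⟩
    A ^ suc (suc m) ∎
    where
    open ≡-Reasoning
    P : ℕ → ℤ
    P k = appell K (suc m) (A * + k)
    increment : ∀ k → P (suc k) - P k ≡ Σ (suc m) (λ i → + (suc m C suc i) * A ^ suc i * appell K (m ∸ i) (A * + k))
    increment k = trans (cong (λ x → appell K (suc m) x - P k) (trans (cong (A *_) (ℤP.pos-+ 1 k)) (shift A (+ k))))
                        (appell-increment K m (A * + k) A)
      where
      shift : ∀ A k → A * (+ 1 + k) ≡ A * k + A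
      shift = solve-∀
    sum-over-k : ∀ i → Σ a (λ k → + (suc m C suc i) * A ^ suc i * appell K (m ∸ i) (A * + k))
                       ≡ + (suc m C suc i) * A ^ suc i * A * δ (m ∸ i)
    sum-over-k i = begin
      Σ a (λ k → c * appell K (m ∸ i) (A * + k)) ≡⟨ *-distribˡ-Σ a c (λ k → appell K (m ∸ i) (A * + k)) ⟨
      c * Σ a (λ k → appell K (m ∸ i) (A * + k)) ≡⟨ cong (c *_) (Σ-appell-K (m ∸ i)) ⟩
      c * (A * δ (m ∸ i))                        ≡⟨ ℤP.*-assoc c A (δ (m ∸ i)) ⟨
      c * A * δ (m ∸ i)                          ∎
      where c = + (suc m C suc i) * A ^ suc i
    simplify : ∀ A p → + 1 * p * A ≡ A * p
    simplify = solve-∀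

  -- After multiplying by (1+j) d, absorption (1+j) C(m+1,1+j) = (m+1-j) C(m+1,j) brings in the
  -- hypothesis (m+1-j) K (m-j) = W a^(m-j), and 1+j ∣ d a^j pays for the extra factor 1+j;
  -- finally d, being coprime to a, cancels.
  A^[2+m]∣term : ∀ m j → j ≤ m → A ^ (m ∸ j) ∣ + suc (m ∸ j) * K (m ∸ j) →
    A ^ suc (suc m) ∣ + (suc m C suc j) * (A * A) ^ suc j * K (m ∸ j)
  A^[2+m]∣term m j j≤m (divides W [1+r]K≡W*A^r) with [1+n]∣coprime*a^n a j
  ... | d , d⊥a , ℕ∣.divides q d*a^j≡q*[1+j] =
    subst (_∣ term) (pos-^ a (suc (suc m)))
      (coprime-∣-*-cancel term (Coprimality.sym (coprime-^ d⊥a (suc (suc m))))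
        (subst (_∣ + d * term) (sym (pos-^ a (suc (suc m))))
          (divides (+ q * C₀ * W) (ℤP.*-cancelˡ-≡ (+ suc j) _ _ key))))
    where
    open ≡-Reasoning
    r = m ∸ j
    term = + (suc m C suc j) * (A * A) ^ suc j * K r
    C₀ = + (suc m C j)
    C₁ = + (suc m C suc j)
    X = A ^ j
    Y = A ^ r
    absorption : + suc j * C₁ ≡ + suc r * C₀
    absorption = begin
      + suc j * C₁                 ≡⟨ ℤP.pos-* (suc j) _ ⟨
      + (suc j ℕ.* (suc m C suc j)) ≡⟨ cong +_ ([1+k]*nC[1+k]≡[n∸k]*nCk (s≤s j≤m)) ⟩
      + ((suc m ∸ j) ℕ.* (suc m C j)) ≡⟨ cong (λ n → + (n ℕ.* (suc m C j))) (ℕP.+-∸-assoc 1 j≤m) ⟩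
      + (suc r ℕ.* (suc m C j))     ≡⟨ ℤP.pos-* (suc r) _ ⟩
      + suc r * C₀                 ∎
    cofactor : + d * X ≡ + q * + suc j
    cofactor = begin
      + d * X                 ≡⟨ cong (+ d *_) (pos-^ a j) ⟨
      + d * + (a ℕ.^ j)       ≡⟨ ℤP.pos-* d _ ⟨
      + (d ℕ.* a ℕ.^ j)       ≡⟨ cong +_ d*a^j≡q*[1+j] ⟩
      + (q ℕ.* suc j)         ≡⟨ ℤP.pos-* q _ ⟩
      + q * + suc j           ∎
    exponents : A * (A * (X * Y)) ≡ A ^ suc (suc m)
    exponents = cong (λ n → A * (A * n)) (trans (sym (ℤP.^-distribˡ-+-* A j r)) (cong (A ^_) (ℕP.m+[n∸m]≡n j≤m)))
    key : + suc j * (+ d * term) ≡ + suc j * ((+ q * C₀ * W) * A ^ suc (suc m))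
    key = begin
      + suc j * (+ d * (C₁ * (A * A) ^ suc j * K r))
        ≡⟨ cong (λ z → + suc j * (+ d * (C₁ * ((A * A) * z) * K r))) (^-distribʳ-* A A j) ⟩
      + suc j * (+ d * (C₁ * ((A * A) * (X * X)) * K r))
        ≡⟨ regroup₁ (+ suc j) (+ d) C₁ A X (K r) ⟩
      (+ suc j * C₁) * (A * A) * X * (+ d * X) * K r
        ≡⟨ cong₂ (λ u v → u * (A * A) * X * v * K r) absorption cofactor ⟩
      (+ suc r * C₀) * (A * A) * X * (+ q * + suc j) * K r
        ≡⟨ regroup₂ (+ suc r) C₀ A X (+ q) (+ suc j) (K r) ⟩
      + suc j * ((+ q * C₀) * (A * (A * X)) * (+ suc r * K r))
        ≡⟨ cong (λ z → + suc j * ((+ q * C₀) * (A * (A * X)) * z)) [1+r]K≡W*A^r ⟩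
      + suc j * ((+ q * C₀) * (A * (A * X)) * (W * Y))
        ≡⟨ regroup₃ (+ suc j) (+ q) C₀ A X W Y ⟩
      + suc j * ((+ q * C₀ * W) * (A * (A * (X * Y))))
        ≡⟨ cong (λ z → + suc j * ((+ q * C₀ * W) * z)) exponents ⟩
      + suc j * ((+ q * C₀ * W) * A ^ suc (suc m)) ∎
      where
      regroup₁ : ∀ s d c A X k → s * (d * (c * ((A * A) * (X * X)) * k)) ≡ (s * c) * (A * A) * X * (d * X) * k
      regroup₁ = solve-∀
      regroup₂ : ∀ s c A X q t k → (s * c) * (A * A) * X * (q * t) * k ≡ t * ((q * c) * (A * (A * X)) * (s * k))
      regroup₂ = solve-∀
      regroup₃ : ∀ t q c A X W Y → t * ((q * c) * (A * (A * X)) * (W * Y)) ≡ t * ((q * c * W) * (A * (A * (X * Y))))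
      regroup₃ = solve-∀

  -- Opaque because Gℤ is extracted from this proof, which the type checker must never unfold.
  opaque
    A^m∣[1+m]K : ∀ m → A ^ m ∣ + suc m * K m
    A^m∣[1+m]K = <-rec _ step
      where
      step : ∀ m → (∀ {r} → r < m → A ^ r ∣ + suc r * K r) → A ^ m ∣ + suc m * K m
      step m ih = *-cancelˡ-∣ A (*-cancelˡ-∣ A (∣m+n∣n⇒∣m A^[2+m]∣head+tail A^[2+m]∣tail))
        where
        tail-term : ℕ → ℤ
        tail-term i = + (suc m C suc (suc i)) * (A * A) ^ suc (suc i) * K (m ∸ suc i)
        head : + (suc m C 1) * (A * A) ^ 1 * K m ≡ A * (A * (+ suc m * K m))
        head = trans (cong (λ c → + c * (A * A) ^ 1 * K m) (nC1≡n (suc m))) (regroup (+ suc m) A (K m))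
          where
          regroup : ∀ n A k → n * (A * A * 1ℤ) * k ≡ A * (A * (n * k))
          regroup = solve-∀
        A^[2+m]∣head+tail : A ^ suc (suc m) ∣ A * (A * (+ suc m * K m)) + Σ m tail-term
        A^[2+m]∣head+tail = subst (A ^ suc (suc m) ∣_) (trans (sym (K-telescoped m)) (cong (_+ Σ m tail-term) head)) ∣-refl
        A^[2+m]∣tail : A ^ suc (suc m) ∣ Σ m tail-term
        A^[2+m]∣tail = Σ-∣ m (λ i i<m → A^[2+m]∣term m (suc i) i<m (ih (ℕP.∸-monoʳ-< (s≤s z≤n) i<m)))

  Gℤ : ℕ → ℤ
  Gℤ zero    = 0ℤ
  Gℤ (suc m) = quotient (A^m∣[1+m]K m)

  [1+m]K≡Gℤ[1+m]*A^m : ∀ m → + suc m * K m ≡ Gℤ (suc m) * A ^ m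
  [1+m]K≡Gℤ[1+m]*A^m m = _∣_.equality (A^m∣[1+m]K m)

  A^m≢0 : ∀ m → ℤ.NonZero (A ^ m)
  A^m≢0 m = ℤ.≢-nonZero (λ A^m≡0 → ℕ.≢-nonZero⁻¹ a (cong ℤ.∣_∣ (ℤP.i^n≡0⇒i≡0 A m A^m≡0)))

  Gℤ-convolution : ∀ m → Σ (suc (suc m)) (λ j → + (suc m C j) * powerSum j * Gℤ (suc m ∸ j)) ≡ A * δ m
  Gℤ-convolution m = ℤP.*-cancelˡ-≡ (A ^ m) (Σ (suc (suc m)) t) (A * δ m) {{A^m≢0 m}} (begin
    A ^ m * Σ (suc (suc m)) t
      ≡⟨ cong (A ^ m *_) (trans (Σ-last (suc m) t) (cong (λ z → Σ (suc m) t + z) last-vanishes)) ⟩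
    A ^ m * (Σ (suc m) t + 0ℤ)
      ≡⟨ cong (A ^ m *_) (ℤP.+-identityʳ (Σ (suc m) t)) ⟩
    A ^ m * Σ (suc m) t
      ≡⟨ *-distribˡ-Σ (suc m) (A ^ m) t ⟩
    Σ (suc m) (λ j → A ^ m * t j)
      ≡⟨ Σ-cong (suc m) (λ j j<1+m → scaled-term j (ℕP.≤-pred j<1+m)) ⟩
    Σ (suc m) (λ j → + suc m * (+ (m C j) * A ^ j * powerSum j * K (m ∸ j)))
      ≡⟨ *-distribˡ-Σ (suc m) (+ suc m) (λ j → + (m C j) * A ^ j * powerSum j * K (m ∸ j)) ⟨
    + suc m * Σ (suc m) (λ j → + (m C j) * A ^ j * powerSum j * K (m ∸ j))
      ≡⟨ cong (+ suc m *_) (K-convolution m) ⟩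
    + suc m * (A * δ m)
      ≡⟨ [1+m]*Aδ≡A^m*Aδ m ⟩
    A ^ m * (A * δ m) ∎)
    where
    open ≡-Reasoning
    t : ℕ → ℤ
    t j = + (suc m C j) * powerSum j * Gℤ (suc m ∸ j)
    last-vanishes : t (suc m) ≡ 0ℤ
    last-vanishes = trans (cong (λ k → + (suc m C suc m) * powerSum (suc m) * Gℤ k) (ℕP.n∸n≡0 m))
                          (ℤP.*-zeroʳ (+ (suc m C suc m) * powerSum (suc m)))
    [1+m]*Aδ≡A^m*Aδ : ∀ m → + suc m * (A * δ m) ≡ A ^ m * (A * δ m)
    [1+m]*Aδ≡A^m*Aδ zero    = refl
    [1+m]*Aδ≡A^m*Aδ (suc m) = trans (vanishes (+ suc (suc m))) (sym (vanishes (A ^ suc m)))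
      where
      vanishes : ∀ x → x * (A * 0ℤ) ≡ 0ℤ
      vanishes x = trans (cong (x *_) (ℤP.*-zeroʳ A)) (ℤP.*-zeroʳ x)
    scaled-term : ∀ j → j ≤ m → A ^ m * t j ≡ + suc m * (+ (m C j) * A ^ j * powerSum j * K (m ∸ j))
    scaled-term j j≤m = begin
      A ^ m * (C₁ * s * Gℤ (suc m ∸ j))
        ≡⟨ cong₂ (λ u v → u * (C₁ * s * Gℤ v)) A^m≡A^j*A^r (ℕP.+-∸-assoc 1 j≤m) ⟩
      A ^ j * A ^ r * (C₁ * s * Gℤ (suc r))
        ≡⟨ regroup₁ (A ^ j) (A ^ r) C₁ s (Gℤ (suc r)) ⟩
      C₁ * A ^ j * s * (Gℤ (suc r) * A ^ r)
        ≡⟨ cong (C₁ * A ^ j * s *_) ([1+m]K≡Gℤ[1+m]*A^m r) ⟨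
      C₁ * A ^ j * s * (+ suc r * K r)
        ≡⟨ regroup₂ C₁ (A ^ j) s (+ suc r) (K r) ⟩
      (+ suc r * C₁) * A ^ j * s * K r
        ≡⟨ cong (λ z → z * A ^ j * s * K r) absorption ⟩
      (+ suc m * + (m C j)) * A ^ j * s * K r
        ≡⟨ regroup₃ (+ suc m) (+ (m C j)) (A ^ j) s (K r) ⟩
      + suc m * (+ (m C j) * A ^ j * s * K r) ∎
      where
      r = m ∸ j
      s = powerSum j
      C₁ = + (suc m C j)
      A^m≡A^j*A^r : A ^ m ≡ A ^ j * A ^ r
      A^m≡A^j*A^r = trans (cong (A ^_) (sym (ℕP.m+[n∸m]≡n j≤m))) (ℤP.^-distribˡ-+-* A j r)
      absorption : + suc r * C₁ ≡ + suc m * + (m C j)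
      absorption = begin
        + suc r * C₁                      ≡⟨ ℤP.pos-* (suc r) _ ⟨
        + (suc r ℕ.* (suc m C j))         ≡⟨ cong (λ n → + (n ℕ.* (suc m C j))) (ℕP.+-∸-assoc 1 j≤m) ⟨
        + ((suc m ∸ j) ℕ.* (suc m C j))   ≡⟨ cong +_ ([1+n∸k]*[1+n]Ck≡[1+n]*nCk j≤m) ⟩
        + (suc m ℕ.* (m C j))             ≡⟨ ℤP.pos-* (suc m) _ ⟩
        + suc m * + (m C j)               ∎
      regroup₁ : ∀ x y c s q → x * y * (c * s * q) ≡ c * x * s * (q * y)
      regroup₁ = solve-∀
      regroup₂ : ∀ c x s n k → c * x * s * (n * k) ≡ (n * c) * x * s * k
      regroup₂ = solve-∀
      regroup₃ : ∀ n c x s k → (n * c) * x * s * k ≡ n * (c * x * s * k)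
      regroup₃ = solve-∀

  powerSum≡S : ∀ j → + S a j ≡ powerSum j
  powerSum≡S j = begin
    + S a j                                          ≡⟨ cong (λ l → + foldr ℕ._+_ 0 l) (map-upTo (λ k → k ℕ.^ j) a) ⟩
    + foldr ℕ._+_ 0 (applyUpTo (λ k → k ℕ.^ j) a)   ≡⟨ pos-foldr-applyUpTo a (λ k → k ℕ.^ j) ⟩
    Σ a (λ k → + (k ℕ.^ j))                          ≡⟨ Σ-cong-≗ a (λ k → pos-^ k j) ⟩
    powerSum j                                       ∎
    where open ≡-Reasoning

  G≡Gℤ : ∀ n → G a n ≡ ℤtoℚ (Gℤ n)
  G≡Gℤ = <-rec _ step
    where
    step : ∀ n → (∀ {i} → i < n → G a i ≡ ℤtoℚ (Gℤ i)) → G a n ≡ ℤtoℚ (Gℤ n)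
    step zero    _  = trans (G-next a 0) (ℚP.*-zeroʳ (invℕ a))
    step (suc m) ih = begin
      G a (suc m)
        ≡⟨ G-next a (suc m) ⟩
      invℕ a ℚ.* (rhsCoeff a (suc m) ℚ.- sumℚ (map F (upTo (suc m))))
        ≡⟨ cong₂ (λ r s → invℕ a ℚ.* (r ℚ.- s)) (rhsCoeff≡ m)
                 (trans (cong sumℚ (map-upTo F (suc m))) (sumℚ-applyUpTo (suc m) F t F≡t)) ⟩
      invℕ a ℚ.* (ℤtoℚ (A * δ m) ℚ.- ℤtoℚ (Σ (suc m) t))
        ≡⟨ cong (invℕ a ℚ.*_) (ℤtoℚ-- (A * δ m) (Σ (suc m) t)) ⟨
      invℕ a ℚ.* ℤtoℚ (A * δ m - Σ (suc m) t)
        ≡⟨ cong (λ z → invℕ a ℚ.* ℤtoℚ z) A*Gℤ≡Aδ-Σ ⟨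
      invℕ a ℚ.* ℤtoℚ (A * Gℤ (suc m))
        ≡⟨ invℕ-cancel a (Gℤ (suc m)) ⟩
      ℤtoℚ (Gℤ (suc m)) ∎
      where
      open ≡-Reasoning
      F : ℕ → ℚ
      F i = ℕtoℚ ((suc m C suc i) ℕ.* S a (suc i)) ℚ.* lookupD (table a (suc m)) (suc m ∸ suc i)
      t : ℕ → ℤ
      t i = + (suc m C suc i) * powerSum (suc i) * Gℤ (m ∸ i)
      F≡t : ∀ i → i < suc m → F i ≡ ℤtoℚ (t i)
      F≡t i _ = begin
        F i
          ≡⟨ cong (ℕtoℚ ((suc m C suc i) ℕ.* S a (suc i)) ℚ.*_)
                  (trans (lookupD-table a (suc m) (m ∸ i) m∸i<1+m) (ih m∸i<1+m)) ⟩
        ℤtoℚ (+ ((suc m C suc i) ℕ.* S a (suc i))) ℚ.* ℤtoℚ (Gℤ (m ∸ i))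
          ≡⟨ ℤtoℚ-* (+ ((suc m C suc i) ℕ.* S a (suc i))) (Gℤ (m ∸ i)) ⟨
        ℤtoℚ (+ ((suc m C suc i) ℕ.* S a (suc i)) * Gℤ (m ∸ i))
          ≡⟨ cong (λ c → ℤtoℚ (c * Gℤ (m ∸ i))) (trans (ℤP.pos-* (suc m C suc i) (S a (suc i)))
                                                      (cong (+ (suc m C suc i) *_) (powerSum≡S (suc i)))) ⟩
        ℤtoℚ (t i) ∎
        where
        m∸i<1+m : m ∸ i < suc m
        m∸i<1+m = s≤s (ℕP.m∸n≤m m i)
      rhsCoeff≡ : ∀ m → rhsCoeff a (suc m) ≡ ℤtoℚ (A * δ m)
      rhsCoeff≡ zero    = cong ℤtoℚ (sym (ℤP.*-identityʳ A))
      rhsCoeff≡ (suc m) = cong ℤtoℚ (sym (ℤP.*-zeroʳ A))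
      A*Gℤ≡Aδ-Σ : A * Gℤ (suc m) ≡ A * δ m - Σ (suc m) t
      A*Gℤ≡Aδ-Σ = isolate A (Gℤ (suc m)) (Σ (suc m) t) (A * δ m)
        (trans (cong (λ s → + 1 * s * Gℤ (suc m) + Σ (suc m) t) (sym powerSum-zero)) (Gℤ-convolution m))
        where
        isolate : ∀ A x t y → + 1 * A * x + t ≡ y → A * x ≡ y - t
        isolate A x t y eq = trans (solve A x t) (cong (_- t) eq)
          where
          solve : ∀ A x t → A * x ≡ (+ 1 * A * x + t) - t
          solve = solve-∀

Genocchi-divisible : ∀ a .{{_ : NonZero a}} n p → p ℕ∣.∣ n → Coprime p a → ∃ λ (k : ℤ) → G a n ≡ ℤtoℚ (k * + p)
Genocchi-divisible a zero    p _ _ = 0ℤ , G≡Gℤ a 0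
Genocchi-divisible a (suc m) p p∣1+m p⊥a =
  quotient p∣Gℤ , trans (G≡Gℤ a (suc m)) (cong ℤtoℚ (_∣_.equality p∣Gℤ))
  where
  [1+m]K≡a^m*Gℤ : + suc m * K a m ≡ + (a ℕ.^ m) * Gℤ a (suc m)
  [1+m]K≡a^m*Gℤ = trans ([1+m]K≡Gℤ[1+m]*A^m a m)
    (trans (ℤP.*-comm (Gℤ a (suc m)) (A a ^ m)) (cong (_* Gℤ a (suc m)) (sym (pos-^ a m))))
  p∣Gℤ : + p ∣ Gℤ a (suc m)
  p∣Gℤ = coprime-∣-*-cancel (Gℤ a (suc m)) (coprime-^ p⊥a m)
    (subst (+ p ∣_) [1+m]K≡a^m*Gℤ (∣m⇒∣m*n (K a m) (∣ᵤ⇒∣ {+ p} {+ suc m} p∣1+m)))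

theorem2p1 : (a : ℕ) → 2 ≤ a → (n : ℕ) → 1 ≤ n →
    ∃ λ (k : ℤ) → G a n ≡ ℤtoℚ (k * + π a n)
theorem2p1 a@(suc _) _ n _ =
  let π∣n , π⊥a = πsearch-spec a n n in Genocchi-divisible a n (π a n) π∣n π⊥a
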